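{- Let $n\ge s\ge0$ be integers with $s>4n/11$, let $G\in\mathfrak{E}(n,s)$, let $H$ be a graph and $(\varphi,\psi)$ an $H$-mould for $G$. If $XY$ is an edge of $\mathcal{F}_G$ and $i,j,k\in V(H)$ are distinct, then some edge of $\mathcal{F}_G$ connects a vertex from $\{X,Y\}$ with a vertex from $\{\varphi(i),\varphi(j),\varphi(k)\}$.
   Context: All graphs are finite and simple. For integers $n\ge s\ge 0$, $\mathrm{ex}(n,s)$ is the maximum number of edges in a triangle-free graph on $n$ vertices with independence number at most $s$, and $\mathfrak{E}(n,s)$ is the family of triangle-free graphs $G$ on $n$ vertices with $\alpha(G)\le s$ and exactly $\mathrm{ex}(n,s)$ edges. The fortress $\mathcal{F}_G$ of $G\in\mathfrak{E}(n,s)$ is the graph whose vertices are the independent sets $X\subseteq V(G)$ with $|X|=s$, two such sets being adjacent iff they are disjoint. An imprint of a graph $H$ in $G$ is an injective map $\varphi\colon V(H)\to V(\mathcal{F}_G)$ such that for all $x,y\in V(H)$: $xy\in E(H)$ iff $\varphi(x)\varphi(y)\in E(\mathcal{F}_G)$. An $H$-mould for $G$ is a pair $(\varphi,\psi)$ of maps $V(H)\to\mathcal{P}(V(G))$ such that $\varphi$ is an imprint of $H$ in $G$ and for every $x\in V(H)$, $\psi(x)$ is an independent set of size $3s-n$ in $G$ and every vertex of $\psi(x)$ is adjacent to every vertex of $\varphi(x)$. -}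

module Defs where

open import Data.Nat using (ℕ; _+_; _*_; _≤_; _<_)
open import Data.Bool using (Bool; true; false; if_then_else_; _∧_)
open import Data.Fin using (Fin; _<?_)
open import Data.Fin.Subset using (Subset; _∈_; ∣_∣)
open import Data.Product using (_×_; Σ; ∃)
open import Data.Sum using (_⊎_)
open import Data.Empty using (⊥)
open import Data.List using (List; map; allFin)
open import Data.Nat.ListAction using (sum)
open import Relation.Nullary using (¬_)
open import Relation.Nullary.Decidable using (⌊_⌋)
open import Relation.Binary.PropositionalEquality using (_≡_; _≢_)

record Graph (n : ℕ) : Set where
  field
    adj   : Fin n → Fin n → Bool
    sym   : ∀ u v → adj u v ≡ adj v u
    irref : ∀ v → adj v v ≡ false

open Graph public

Adj : ∀ {n} → Graph n → Fin n → Fin n → Set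
Adj G u v = adj G u v ≡ true

edgeCount : ∀ {n} → Graph n → ℕ
edgeCount {n} G =
  sum (map (λ u → sum (map (λ v → if ⌊ u <? v ⌋ ∧ adj G u v then 1 else 0)
                          (allFin n)))
           (allFin n))

TriangleFree : ∀ {n} → Graph n → Set
TriangleFree G = ∀ u v w → Adj G u v → Adj G v w → Adj G u w → ⊥

Independent : ∀ {n} → Graph n → Subset n → Set
Independent G X = ∀ u v → u ∈ X → v ∈ X → ¬ Adj G u v

IndepNumAtMost : ∀ {n} → Graph n → ℕ → Set
IndepNumAtMost G s = ∀ X → Independent G X → ∣ X ∣ ≤ s

-- G ∈ 𝔈(n,s): triangle-free, α(G) ≤ s, and edge count equal to ex(n,s),
-- i.e. at least the edge count of every triangle-free graph on n vertices
-- with independence number at most s (G itself belongs to that family).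
InExtremal : (n s : ℕ) → Graph n → Set
InExtremal n s G =
  TriangleFree G × IndepNumAtMost G s ×
  (∀ (G' : Graph n) → TriangleFree G' → IndepNumAtMost G' s →
     edgeCount G' ≤ edgeCount G)

Disjoint : ∀ {n} → Subset n → Subset n → Set
Disjoint X Y = ∀ v → v ∈ X → v ∈ Y → ⊥

FortressVertex : ∀ {n} → Graph n → ℕ → Subset n → Set
FortressVertex G s X = Independent G X × ∣ X ∣ ≡ s

-- adjacency in 𝓕_G (a simple graph): distinct and disjoint
-- (both arguments are assumed to be fortress vertices)
FortressAdj : ∀ {n} → Subset n → Subset n → Set
FortressAdj X Y = X ≢ Y × Disjoint X Y

Imprint : ∀ {n m} → Graph n → ℕ → Graph m → (Fin m → Subset n) → Set
Imprint {n} {m} G s H φ =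
  (∀ x → FortressVertex G s (φ x)) ×
  (∀ x y → φ x ≡ φ y → x ≡ y) ×
  (∀ x y → (Adj H x y → FortressAdj (φ x) (φ y)) ×
           (FortressAdj (φ x) (φ y) → Adj H x y))

-- an H-mould (φ, ψ) for G; |ψ x| = 3s - n is written |ψ x| + n = 3s
Mould : ∀ {n m} → Graph n → ℕ → Graph m →
        (Fin m → Subset n) → (Fin m → Subset n) → Set
Mould {n} G s H φ ψ =
  Imprint G s H φ ×
  (∀ x → Independent G (ψ x) × ∣ ψ x ∣ + n ≡ 3 * s ×
         (∀ u v → u ∈ ψ x → v ∈ φ x → Adj G u v))

-- If X or Y meets φ(x), then ψ(x) avoids X ∪ Y, because ψ(x) is complete to
-- φ(x) and X, Y are independent.  Distinct i, j give disjoint ψ(i), ψ(j): a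
-- common vertex u would have φ(i) ∪ φ(j) inside its neighbourhood, which is
-- independent since G is triangle-free, so |φ(i) ∪ φ(j)| ≤ s forces
-- φ(i) = φ(j).  Hence if no edge of the fortress joined {X, Y} to
-- {φ(i), φ(j), φ(k)}, the sets X, Y, ψ(i), ψ(j), ψ(k) would be pairwise
-- disjoint, giving 2s + 3(3s - n) ≤ n, i.e. 11s ≤ 4n.  Only triangle-freeness
-- and α(G) ≤ s are used, not extremality.
module Submission where

open import Defs
open import Data.Nat using (ℕ; zero; suc; _+_; _*_; _≤_; _<_; z≤n; s≤s)
open import Data.Nat.Properties using (+-suc; *-zeroʳ; +-monoˡ-≤; <⇒≱; ≤⇒≯; n≮0; module ≤-Reasoning)
open import Data.Nat.ListAction using (sum)
open import Data.Nat.Tactic.RingSolver using (solve-∀)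
open import Data.Fin using (Fin)
open import Data.Fin.Properties using (any?)
open import Data.Fin.Subset using (Subset; _∈_; _∪_; ⋃; ⊥; ∣_∣; inside; outside; Empty)
open import Data.Fin.Subset.Properties
  using (_∈?_; x∈p∪q⁻; p⊆p∪q; q⊆p∪q; p⊂q⇒∣p∣<∣q∣; ⊆-antisym; ∣p∣≤n; ∉⊥; Empty-unique; ∣⊥∣≡0)
open import Data.List using (List; []; _∷_; map)
open import Data.List.Relation.Unary.All using (All; []; _∷_)
open import Data.List.Relation.Unary.AllPairs using (AllPairs; []; _∷_)
open import Data.Product using (_×_; ∃; _,_; proj₁; proj₂)
open import Data.Sum using (_⊎_; inj₁; inj₂)
open import Data.Vec using ([]; _∷_; here; there)
open import Relation.Nullary using (yes; no; contradiction)
open import Relation.Nullary.Decidable using (_×-dec_)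
open import Relation.Binary.PropositionalEquality
  using (_≡_; _≢_; refl; trans; cong; cong₂; subst; module ≡-Reasoning) renaming (sym to ≡-sym)

private
  variable
    n m s : ℕ
    x y z : Fin m
    p q r : Subset n

Meets : Subset n → Subset n → Set
Meets p q = ∃ λ v → v ∈ p × v ∈ q

disjoint⊎meets : (p q : Subset n) → Disjoint p q ⊎ Meets p q
disjoint⊎meets p q with any? (λ v → (v ∈? p) ×-dec (v ∈? q))
... | yes p∩q = inj₂ p∩q
... | no ¬p∩q = inj₁ (λ v v∈p v∈q → ¬p∩q (v , v∈p , v∈q))

Disjoint-∪ʳ : Disjoint p q → Disjoint p r → Disjoint p (q ∪ r)
Disjoint-∪ʳ {q = q} {r = r} p#q p#r v v∈p v∈q∪r with x∈p∪q⁻ q r v∈q∪r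
... | inj₁ v∈q = p#q v v∈p v∈q
... | inj₂ v∈r = p#r v v∈p v∈r

Disjoint-⋃ : {ps : List (Subset n)} → All (Disjoint p) ps → Disjoint p (⋃ ps)
Disjoint-⋃ []            v _ v∈⊥ = ∉⊥ v∈⊥
Disjoint-⋃ (p#q ∷ p#qs) = Disjoint-∪ʳ p#q (Disjoint-⋃ p#qs)

Disjoint-tail : ∀ {a b} → Disjoint (a ∷ p) (b ∷ q) → Disjoint p q
Disjoint-tail p#q v v∈p v∈q = p#q _ (there v∈p) (there v∈q)

∣p∪q∣≡∣p∣+∣q∣ : (p q : Subset n) → Disjoint p q → ∣ p ∪ q ∣ ≡ ∣ p ∣ + ∣ q ∣
∣p∪q∣≡∣p∣+∣q∣ []            []            _   = refl
∣p∪q∣≡∣p∣+∣q∣ (inside ∷ p)  (inside ∷ q)  p#q = contradiction here (λ v∈q → p#q _ here v∈q)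
∣p∪q∣≡∣p∣+∣q∣ (inside ∷ p)  (outside ∷ q) p#q = cong suc (∣p∪q∣≡∣p∣+∣q∣ p q (Disjoint-tail p#q))
∣p∪q∣≡∣p∣+∣q∣ (outside ∷ p) (inside ∷ q)  p#q =
  trans (cong suc (∣p∪q∣≡∣p∣+∣q∣ p q (Disjoint-tail p#q))) (≡-sym (+-suc ∣ p ∣ ∣ q ∣))
∣p∪q∣≡∣p∣+∣q∣ (outside ∷ p) (outside ∷ q) p#q = ∣p∪q∣≡∣p∣+∣q∣ p q (Disjoint-tail p#q)

∣⋃ps∣≡sum : (ps : List (Subset n)) → AllPairs Disjoint ps → ∣ ⋃ ps ∣ ≡ sum (map ∣_∣ ps)
∣⋃ps∣≡sum {n} []       []                  = ∣⊥∣≡0 n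
∣⋃ps∣≡sum (p ∷ ps) (p#ps ∷ disjoint) = begin
  ∣ p ∪ ⋃ ps ∣             ≡⟨ ∣p∪q∣≡∣p∣+∣q∣ p (⋃ ps) (Disjoint-⋃ p#ps) ⟩
  ∣ p ∣ + ∣ ⋃ ps ∣         ≡⟨ cong (∣ p ∣ +_) (∣⋃ps∣≡sum ps disjoint) ⟩
  ∣ p ∣ + sum (map ∣_∣ ps) ∎
  where open ≡-Reasoning

sum-∣∣-≤ : (ps : List (Subset n)) → AllPairs Disjoint ps → sum (map ∣_∣ ps) ≤ n
sum-∣∣-≤ ps disjoint = subst (_≤ _) (∣⋃ps∣≡sum ps disjoint) (∣p∣≤n (⋃ ps))

Disjoint-self⇒∣p∣≡0 : Disjoint p p → ∣ p ∣ ≡ 0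
Disjoint-self⇒∣p∣≡0 {n} {p} p#p = trans (cong ∣_∣ (Empty-unique p-empty)) (∣⊥∣≡0 n)
  where
  p-empty : Empty p
  p-empty (v , v∈p) = p#p v v∈p v∈p

⊆-∣∣≥⇒≡ : (∀ {v} → v ∈ p → v ∈ q) → ∣ q ∣ ≤ ∣ p ∣ → p ≡ q
⊆-∣∣≥⇒≡ {p = p} p⊆q ∣q∣≤∣p∣ = ⊆-antisym p⊆q q⊆p
  where
  q⊆p : ∀ {v} → v ∈ _ → v ∈ p
  q⊆p {v} v∈q with v ∈? p
  ... | yes v∈p = v∈p
  ... | no  v∉p = contradiction (p⊂q⇒∣p∣<∣q∣ (p⊆q , v , v∈q , v∉p)) (≤⇒≯ ∣q∣≤∣p∣)

Disjoint⇒FortressAdj : 0 < ∣ p ∣ → Disjoint p q → FortressAdj p q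
Disjoint⇒FortressAdj {p = p} 0<∣p∣ p#q = p≢q , p#q
  where
  p≢q : p ≢ _
  p≢q refl = n≮0 (subst (0 <_) (Disjoint-self⇒∣p∣≡0 p#q) 0<∣p∣)

adjacent⊎meets : 0 < ∣ p ∣ → 0 < ∣ q ∣ → (r : Subset n) →
                 (∃ λ a → (a ≡ p ⊎ a ≡ q) × FortressAdj a r) ⊎ (Meets p r × Meets q r)
adjacent⊎meets {p = p} {q} 0<∣p∣ 0<∣q∣ r with disjoint⊎meets p r | disjoint⊎meets q r
... | inj₁ p#r | _        = inj₁ (p , inj₁ refl , Disjoint⇒FortressAdj 0<∣p∣ p#r)
... | inj₂ _   | inj₁ q#r = inj₁ (q , inj₂ refl , Disjoint⇒FortressAdj 0<∣q∣ q#r)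
... | inj₂ p∩r | inj₂ q∩r = inj₂ (p∩r , q∩r)

m<n*o⇒0<o : ∀ {m} n {o} → m < n * o → 0 < o
m<n*o⇒0<o {m} n {zero} m<n*0 = contradiction (subst (m <_) (*-zeroʳ n) m<n*0) n≮0
m<n*o⇒0<o     n {suc o} _     = s≤s z≤n

sum≤n⇒11s≤4n : ∀ {s n x y a b c} → x ≡ s → y ≡ s → a + n ≡ 3 * s → b + n ≡ 3 * s → c + n ≡ 3 * s →
               sum (x ∷ y ∷ a ∷ b ∷ c ∷ []) ≤ n → 11 * s ≤ 4 * n
sum≤n⇒11s≤4n {s} {n} {a = a} {b} {c} refl refl a+n≡3s b+n≡3s c+n≡3s sum≤n = begin
  11 * s                                     ≡⟨ expand s ⟩
  s + s + (3 * s + (3 * s + 3 * s))          ≡⟨ cong (s + s +_) (≡-sym (cong₂ _+_ a+n≡3s (cong₂ _+_ b+n≡3s c+n≡3s))) ⟩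
  s + s + ((a + n) + ((b + n) + (c + n)))    ≡⟨ regroup s a b c n ⟩
  s + (s + (a + (b + (c + 0)))) + 3 * n      ≤⟨ +-monoˡ-≤ (3 * n) sum≤n ⟩
  n + 3 * n                                  ≡⟨ collect n ⟩
  4 * n                                      ∎
  where
  open ≤-Reasoning
  expand : ∀ s → 11 * s ≡ s + s + (3 * s + (3 * s + 3 * s))
  expand = solve-∀
  regroup : ∀ s a b c n → s + s + ((a + n) + ((b + n) + (c + n))) ≡ s + (s + (a + (b + (c + 0)))) + 3 * n
  regroup = solve-∀
  collect : ∀ n → n + 3 * n ≡ 4 * n
  collect = solve-∀

Complete : Graph n → Subset n → Subset n → Set
Complete G p q = ∀ u v → u ∈ p → v ∈ q → Adj G u v

Neighbours : Graph n → Fin n → Subset n → Set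
Neighbours G u q = ∀ v → v ∈ q → Adj G u v

module _ {G : Graph n} where

  neighbourhood-independent : TriangleFree G → ∀ {u} → Neighbours G u p → Independent G p
  neighbourhood-independent triangle-free u~p v w v∈p w∈p v~w = triangle-free _ v w (u~p v v∈p) v~w (u~p w w∈p)

  common-neighbour⇒≡ : TriangleFree G → IndepNumAtMost G s → ∣ p ∣ ≡ s → ∣ q ∣ ≡ s →
                       ∀ {u} → Neighbours G u p → Neighbours G u q → p ≡ q
  common-neighbour⇒≡ {s = s} {p = p} {q = q} triangle-free α≤s ∣p∣≡s ∣q∣≡s u~p u~q =
    trans (⊆-∣∣≥⇒≡ (p⊆p∪q q) (∣p∪q∣≤ p ∣p∣≡s)) (≡-sym (⊆-∣∣≥⇒≡ (q⊆p∪q p q) (∣p∪q∣≤ q ∣q∣≡s)))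
    where
    u~p∪q : Neighbours G _ (p ∪ q)
    u~p∪q v v∈p∪q with x∈p∪q⁻ p q v∈p∪q
    ... | inj₁ v∈p = u~p v v∈p
    ... | inj₂ v∈q = u~q v v∈q
    ∣p∪q∣≤ : ∀ r → ∣ r ∣ ≡ s → ∣ p ∪ q ∣ ≤ ∣ r ∣
    ∣p∪q∣≤ _ ∣r∣≡s = subst (_ ≤_) (≡-sym ∣r∣≡s) (α≤s (p ∪ q) (neighbourhood-independent triangle-free u~p∪q))

  complete-to-met⇒Disjoint : Independent G r → Complete G p q → Meets r q → Disjoint r p
  complete-to-met⇒Disjoint r-indep p~q (v , v∈r , v∈q) u u∈r u∈p = r-indep u v u∈r v∈r (p~q u v u∈p v∈q)

  module _ {H : Graph m} {φ ψ : Fin m → Subset n} where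

    mould-ψ-disjoint : Mould G s H φ ψ → TriangleFree G → IndepNumAtMost G s → x ≢ y → Disjoint (ψ x) (ψ y)
    mould-ψ-disjoint {x = x} {y = y} ((φ-vertex , φ-injective , _) , ψ-prop) triangle-free α≤s x≢y u u∈ψx u∈ψy =
      x≢y (φ-injective x y (common-neighbour⇒≡ triangle-free α≤s
                             (proj₂ (φ-vertex x)) (proj₂ (φ-vertex y)) (ψ~φ x u∈ψx) (ψ~φ y u∈ψy)))
      where
      ψ~φ : ∀ z {u} → u ∈ ψ z → Neighbours G u (φ z)
      ψ~φ z u∈ψz v = proj₂ (proj₂ (ψ-prop z)) _ v u∈ψz

    mould-ψ-avoids : Mould G s H φ ψ → Independent G r → Meets r (φ x) → Disjoint r (ψ x)
    mould-ψ-avoids {x = x} (_ , ψ-prop) r-indep = complete-to-met⇒Disjoint r-indep (proj₂ (proj₂ (ψ-prop x)))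

    ∣ψ∣+n≡3s : Mould G s H φ ψ → ∀ x → ∣ ψ x ∣ + n ≡ 3 * s
    ∣ψ∣+n≡3s (_ , ψ-prop) x = proj₁ (proj₂ (ψ-prop x))

    mould-meets⇒11s≤4n : Mould G s H φ ψ → TriangleFree G → IndepNumAtMost G s →
                         FortressVertex G s p → FortressVertex G s q → Disjoint p q →
                         x ≢ y → y ≢ z → x ≢ z →
                         Meets p (φ x) × Meets q (φ x) → Meets p (φ y) × Meets q (φ y) →
                         Meets p (φ z) × Meets q (φ z) → 11 * s ≤ 4 * n
    mould-meets⇒11s≤4n {p = p} {q} {x} {y} {z} mould triangle-free α≤s (p-indep , ∣p∣≡s) (q-indep , ∣q∣≡s) p#q
                       x≢y y≢z x≢z (p∩φx , q∩φx) (p∩φy , q∩φy) (p∩φz , q∩φz) =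
      sum≤n⇒11s≤4n ∣p∣≡s ∣q∣≡s (∣ψ∣+n≡3s mould x) (∣ψ∣+n≡3s mould y) (∣ψ∣+n≡3s mould z)
                   (sum-∣∣-≤ (p ∷ q ∷ ψ x ∷ ψ y ∷ ψ z ∷ []) pairwise-disjoint)
      where
      p#ψ : ∀ {w} → Meets p (φ w) → Disjoint p (ψ w)
      p#ψ = mould-ψ-avoids mould p-indep
      q#ψ : ∀ {w} → Meets q (φ w) → Disjoint q (ψ w)
      q#ψ = mould-ψ-avoids mould q-indep
      ψ# : ∀ {v w} → v ≢ w → Disjoint (ψ v) (ψ w)
      ψ# = mould-ψ-disjoint mould triangle-free α≤s
      pairwise-disjoint : AllPairs Disjoint (p ∷ q ∷ ψ x ∷ ψ y ∷ ψ z ∷ [])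
      pairwise-disjoint = (p#q ∷ p#ψ p∩φx ∷ p#ψ p∩φy ∷ p#ψ p∩φz ∷ [])
                        ∷ (q#ψ q∩φx ∷ q#ψ q∩φy ∷ q#ψ q∩φz ∷ [])
                        ∷ (ψ# x≢y ∷ ψ# x≢z ∷ [])
                        ∷ (ψ# y≢z ∷ [])
                        ∷ []
                        ∷ []

fact4p2 : (n s : ℕ) → s ≤ n → 4 * n < 11 * s →
    (G : Graph n) → InExtremal n s G →
    {m : ℕ} (H : Graph m) (φ ψ : Fin m → Subset n) → Mould G s H φ ψ →
    (X Y : Subset n) → FortressVertex G s X → FortressVertex G s Y → FortressAdj X Y →
    (i j k : Fin m) → i ≢ j → j ≢ k → i ≢ k →
    ∃ λ (A : Subset n) → ∃ λ (B : Subset n) →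
      (A ≡ X ⊎ A ≡ Y) × (B ≡ φ i ⊎ (B ≡ φ j ⊎ B ≡ φ k)) × FortressAdj A B
fact4p2 n s _ 4n<11s G (triangle-free , α≤s , _) H φ ψ mould X Y X-vertex@(_ , ∣X∣≡s) Y-vertex@(_ , ∣Y∣≡s) (_ , X#Y)
        i j k i≢j j≢k i≢k
  with XY-adjacent⊎meets (φ i) | XY-adjacent⊎meets (φ j) | XY-adjacent⊎meets (φ k)
  where
  positive : ∀ {p} → ∣ p ∣ ≡ s → 0 < ∣ p ∣
  positive ∣p∣≡s = subst (0 <_) (≡-sym ∣p∣≡s) (m<n*o⇒0<o 11 4n<11s)
  XY-adjacent⊎meets = adjacent⊎meets (positive {X} ∣X∣≡s) (positive {Y} ∣Y∣≡s)
... | inj₁ (A , A∈XY , A~φi) | _ | _ = A , φ i , A∈XY , inj₁ refl , A~φi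
... | _ | inj₁ (A , A∈XY , A~φj) | _ = A , φ j , A∈XY , inj₂ (inj₁ refl) , A~φj
... | _ | _ | inj₁ (A , A∈XY , A~φk) = A , φ k , A∈XY , inj₂ (inj₂ refl) , A~φk
... | inj₂ X∩φi,Y∩φi | inj₂ X∩φj,Y∩φj | inj₂ X∩φk,Y∩φk =
  contradiction (mould-meets⇒11s≤4n {G = G} {H = H} mould triangle-free α≤s X-vertex Y-vertex X#Y
                   i≢j j≢k i≢k X∩φi,Y∩φi X∩φj,Y∩φj X∩φk,Y∩φk)
                (<⇒≱ 4n<11s)
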